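{- Let $\sigma$ be a finite signature, $k\ge 1$, and let $\mathbf{B}_1,\ldots,\mathbf{B}_k$ be pairwise non-isomorphic finite structures over $\sigma$ that are all homomorphically equivalent to one another. Then there exists a finite structure $\mathbf{A}_k$ over $\sigma$ such that the values $\mathrm{Hom}(\mathbf{A}_k,\mathbf{B}_1),\ldots,\mathrm{Hom}(\mathbf{A}_k,\mathbf{B}_k)$ are non-zero and pairwise distinct.
   Context: A signature is a finite set of relation symbols, each with an arity. A (finite) structure $\mathbf{B}$ over $\sigma$ consists of a finite universe $B$ and a relation $R^{\mathbf{B}} \subseteq B^{\mathrm{ar}(R)}$ for each $R\in\sigma$. A homomorphism from $\mathbf{A}$ to $\mathbf{B}$ is a map $h:A\to B$ with $h(R^{\mathbf{A}})\subseteq R^{\mathbf{B}}$ for every $R\in\sigma$. $\mathrm{Hom}(\mathbf{A},\mathbf{B})$ denotes the number of homomorphisms from $\mathbf{A}$ to $\mathbf{B}$. Two structures are homomorphically equivalent if each admits a homomorphism to the other. -}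

module Defs where

open import Data.Nat using (ℕ; zero; suc; _+_)
open import Data.Fin using (Fin)
open import Data.Bool using (Bool; true; false; _∧_; if_then_else_)
open import Data.Vec using (Vec; []; _∷_; map; lookup)
open import Data.List.Base using (List; []; _∷_; concatMap; length; filter)
open import Data.Bool.ListAction using (all)
import Data.List as L
open import Data.Fin using (Fin) renaming (zero to fz; suc to fs)
open import Data.List using (allFin)
open import Relation.Binary.PropositionalEquality using (_≡_)
open import Function.Bundles using (_⤖_; Bijection)
open import Data.Product using (Σ; _×_)
open import Function.Base using (_∘_)
open import Data.Bool.Properties using (T?)
open import Data.Bool using (T)

record Signature : Set where
  field
    nsym : ℕ
    ar   : Fin nsym → ℕ
open Signature public

-- A finite structure over σ: universe Fin size (any finite set is in
-- bijection with some Fin m), each relation R ⊆ B^ar(R) given by its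
-- (decidable, since finite) characteristic function.
record Structure (σ : Signature) : Set where
  field
    size : ℕ
    rel  : (R : Fin (nsym σ)) → Vec (Fin size) (ar σ R) → Bool
open Structure public

IsHom : ∀ {σ} (A B : Structure σ) → (Fin (size A) → Fin (size B)) → Set
IsHom {σ} A B h = ∀ (R : Fin (nsym σ)) (t : Vec (Fin (size A)) (ar σ R)) →
  rel A R t ≡ true → rel B R (map h t) ≡ true

HomEquiv : ∀ {σ} (A B : Structure σ) → Set
HomEquiv A B = Σ (Fin (size A) → Fin (size B)) (IsHom A B) ×
               Σ (Fin (size B) → Fin (size A)) (IsHom B A)

Iso : ∀ {σ} (A B : Structure σ) → Set
Iso {σ} A B = Σ (Fin (size A) ⤖ Fin (size B)) λ h →
  ∀ (R : Fin (nsym σ)) (t : Vec (Fin (size A)) (ar σ R)) →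
  rel A R t ≡ rel B R (map (Bijection.to h) t)

allVecs : (m k : ℕ) → List (Vec (Fin m) k)
allVecs m zero    = [] ∷ []
allVecs m (suc k) = concatMap (λ x → L.map (x ∷_) (allVecs m k)) (allFin m)

implies : Bool → Bool → Bool
implies true  b = b
implies false _ = true

isHom? : ∀ {σ} (A B : Structure σ) → Vec (Fin (size B)) (size A) → Bool
isHom? {σ} A B f =
  all (λ R → all (λ t → implies (rel A R t) (rel B R (map (lookup f) t)))
                 (allVecs (size A) (ar σ R)))
      (allFin (nsym σ))

Hom : ∀ {σ} (A B : Structure σ) → ℕ
Hom A B = length (L.filter (λ f → T? (isHom? A B f)) (allVecs (size B) (size A)))

module Submission where

-- (1) Lovász: if B ≇ B′ then Hom(D, B) ≠ Hom(D, B′) for some D. Let HomSep C T E count the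
--     homomorphisms C → T taking different values on each pair in E. Deletion–contraction
--       HomSep C T E = HomSep C T ((a , b) ∷ E) + HomSep (C with a = b) T E
--     shows: if Hom(-, B) and Hom(-, B′) agree on B and on all its iterated quotients, then B and B′
--     receive equally many injective homomorphisms from B, so B embeds into B′. Embedding both ways
--     forces B ≅ B′, by counting elements and tuples. Agreement is a finite, decidable condition, so
--     when B ≇ B′ a structure D on which it fails is found constructively.
-- (2) Hom(A₁ ⊕ A₂, B) = Hom(A₁, B) · Hom(A₂, B) for the disjoint union, hence Hom(Aᵗ, B) = Hom(A, B)ᵗ.
-- (3) Starting from the empty structure, treat the pairs i ≠ j in turn, replacing A by Aᵗ ⊕ D with D
--     separating Bᵢ from Bⱼ: for large t the strict order of the old values survives (a Bernoulli-type
--     inequality) and pairs with equal old values are separated by D. Homomorphic equivalence makes all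
--     values of such a D, hence of every A built, positive.

open import Defs
open import Data.Nat using (ℕ; zero; suc; _+_; _*_; _^_; _≤_; _<_; _≥_; z≤n; s≤s; >-nonZero)
open import Data.Nat.Properties
  using ( ≤-trans; ≤-antisym; ≤-reflexive; m≤m+n; m≤n+m; +-assoc; +-comm; +-suc; +-identityʳ
        ; *-distribʳ-+; *-suc; *-identityʳ; <⇒≱; <⇒≢; <-cmp; +-cancelʳ-≡; *-cancelˡ-≡; *-cancelˡ-≤
        ; m^n>0; n≢0⇒n>0; n>0⇒n≢0; *-mono-<; *-monoʳ-≤; +-monoˡ-<; +-monoʳ-≤; ^-monoˡ-≤
        ; module ≤-Reasoning )
  renaming (_≟_ to _≟ℕ_)
open import Data.Nat.Tactic.RingSolver using (solve-∀)
open import Data.Fin using (Fin; punchIn; punchOut; combine; remQuot; _↑ˡ_; _↑ʳ_) renaming (zero to fz; suc to fs)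
open import Data.Fin.Properties
  using ( _≟_; any?; all?; ¬∀⟶∃¬; punchInᵢ≢i; punchOut-punchIn; punchIn-punchOut; punchOut-cong′
        ; remQuot-combine; combine-remQuot )
  renaming (suc-injective to fs-injective; 0≢1+n to fz≢fs)
open import Data.Bool using (Bool; true; false; _∧_; _∨_; not)
open import Data.Bool.Properties
  using (T?; T-≡; ∧-conicalˡ; ∧-conicalʳ; ∧-zeroʳ; ∧-identityʳ; ∨-zeroʳ) renaming (_≟_ to _≟ᵇ_)
open import Data.Bool.ListAction using (all; any)
open import Data.Vec using (Vec; []; _∷_; lookup; tabulate; _++_) renaming (map to vmap)
open import Data.Vec.Properties
  using ( map-cong; map-∘; map-id; lookup∘tabulate; tabulate∘lookup; tabulate-cong; ≡-dec
        ; lookup-++ˡ; lookup-++ʳ; ∷-injectiveˡ; ∷-injectiveʳ )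
open import Data.List using (List; []; _∷_; length; filter; concatMap; cartesianProduct; allFin)
import Data.List as List
import Data.List.Relation.Unary.All as All
open import Data.List.Relation.Unary.All.Properties using (all⁺; all⁻)
open import Data.List.Relation.Unary.Any using (here; there)
import Data.List.Relation.Unary.Any as Any
open import Data.List.Relation.Unary.Any.Properties using (any⁺; any⁻)
open import Data.List.Membership.Propositional using (_∈_; lose)
open import Data.List.Membership.Propositional.Properties
  using (∈-allFin; ∈-concatMap⁺; ∈-map⁺; ∈-filter⁺; ∈-filter⁻; ∈-cartesianProduct⁺)
open import Data.Product using (Σ; _×_; _,_; proj₁; proj₂; ∃)
open import Data.Empty using (⊥-elim)
open import Relation.Nullary using (¬_; Dec; yes; no; ¬?)
open import Relation.Nullary.Decidable using (does; dec-true; dec-false; _×-dec_)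
open import Relation.Binary.Definitions using (tri<; tri≈; tri>)
open import Relation.Binary.PropositionalEquality
open import Function.Base using (_∘_; id)
open import Function.Definitions using (Injective)
open import Function.Bundles using (Equivalence; mk⤖)

open Equivalence using (to; from)

indicator : Bool → ℕ
indicator true  = 1
indicator false = 0

count : (N : ℕ) → (Fin N → Bool) → ℕ
count zero    P = 0
count (suc N) P = indicator (P fz) + count N (P ∘ fs)

sumFin : (N : ℕ) → (Fin N → ℕ) → ℕ
sumFin zero    F = 0
sumFin (suc N) F = F fz + sumFin N (F ∘ fs)

count-cong : ∀ N {P Q : Fin N → Bool} → (∀ i → P i ≡ Q i) → count N P ≡ count N Q
count-cong zero    e = refl
count-cong (suc N) e = cong₂ _+_ (cong indicator (e fz)) (count-cong N (e ∘ fs))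

sumFin-cong : ∀ N {F G : Fin N → ℕ} → (∀ i → F i ≡ G i) → sumFin N F ≡ sumFin N G
sumFin-cong zero    e = refl
sumFin-cong (suc N) e = cong₂ _+_ (e fz) (sumFin-cong N (e ∘ fs))

term≤sumFin : ∀ N (F : Fin N → ℕ) i → F i ≤ sumFin N F
term≤sumFin (suc N) F fz     = m≤m+n _ _
term≤sumFin (suc N) F (fs i) = ≤-trans (term≤sumFin N (F ∘ fs) i) (m≤n+m _ _)

sumFin-*ʳ : ∀ N (F : Fin N → ℕ) c → sumFin N F * c ≡ sumFin N (λ i → F i * c)
sumFin-*ʳ zero    F c = refl
sumFin-*ʳ (suc N) F c =
  trans (*-distribʳ-+ c (F fz) _) (cong (F fz * c +_) (sumFin-*ʳ N (F ∘ fs) c))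

count-punchIn : ∀ N (j : Fin (suc N)) P →
  count (suc N) P ≡ indicator (P j) + count N (P ∘ punchIn j)
count-punchIn N       fz     P = refl
count-punchIn (suc N) (fs j) P = begin
  x + count (suc N) (P ∘ fs)       ≡⟨ cong (x +_) (count-punchIn N j (P ∘ fs)) ⟩
  x + (y + rest)                   ≡⟨ sym (+-assoc x y rest) ⟩
  (x + y) + rest                   ≡⟨ cong (_+ rest) (+-comm x y) ⟩
  (y + x) + rest                   ≡⟨ +-assoc y x rest ⟩
  y + (x + rest)                   ∎
  where
  open ≡-Reasoning
  x    = indicator (P fz)
  y    = indicator (P (fs j))
  rest = count N (P ∘ fs ∘ punchIn j)

count-punchIn-true : ∀ N (j : Fin (suc N)) P → P j ≡ true →
  count (suc N) P ≡ suc (count N (P ∘ punchIn j))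
count-punchIn-true N j P Pj = trans (count-punchIn N j P) (cong (λ b → indicator b + count N (P ∘ punchIn j)) Pj)

without : ∀ {M} → (Fin M → Bool) → Fin M → Fin M → Bool
without Q j y = Q y ∧ not (does (y ≟ j))

count-without : ∀ M (Q : Fin M → Bool) j → Q j ≡ true → count M Q ≡ suc (count M (without Q j))
count-without (suc M) Q j Qj = begin
  count (suc M) Q                              ≡⟨ count-punchIn-true M j Q Qj ⟩
  suc (count M (Q ∘ punchIn j))                ≡⟨ cong suc (count-cong M kept) ⟩
  suc (count M (without Q j ∘ punchIn j))      ≡⟨ cong (λ b → suc (indicator b + rest)) removed ⟨
  suc (indicator (without Q j j) + rest)       ≡⟨ cong suc (count-punchIn M j (without Q j)) ⟨
  suc (count (suc M) (without Q j))            ∎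
  where
  open ≡-Reasoning
  rest = count M (without Q j ∘ punchIn j)
  removed : without Q j j ≡ false
  removed rewrite dec-true (j ≟ j) refl = ∧-zeroʳ (Q j)
  kept : ∀ y → Q (punchIn j y) ≡ without Q j (punchIn j y)
  kept y rewrite dec-false (punchIn j y ≟ j) (punchInᵢ≢i j y) = sym (∧-identityʳ _)

count-injection : ∀ N M (P : Fin N → Bool) (Q : Fin M → Bool) (φ : Fin N → Fin M) →
  (∀ i → P i ≡ true → Q (φ i) ≡ true) →
  (∀ i j → P i ≡ true → P j ≡ true → φ i ≡ φ j → i ≡ j) →
  count N P ≤ count M Q
count-injection zero    M P Q φ into inj = z≤n
count-injection (suc N) M P Q φ into inj with P fz in P0
... | false = count-injection N M (P ∘ fs) Q (φ ∘ fs) (into ∘ fs)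
                (λ i j p q e → fs-injective (inj (fs i) (fs j) p q e))
... | true  = subst (suc (count N (P ∘ fs)) ≤_) (sym (count-without M Q (φ fz) (into fz P0)))
                (s≤s (count-injection N M (P ∘ fs) (without Q (φ fz)) (φ ∘ fs) into′ inj′))
  where
  into′ : ∀ i → P (fs i) ≡ true → without Q (φ fz) (φ (fs i)) ≡ true
  into′ i p rewrite into (fs i) p
    | dec-false (φ (fs i) ≟ φ fz) (λ e → fz≢fs (inj fz (fs i) P0 p (sym e))) = refl
  inj′ : ∀ i j → P (fs i) ≡ true → P (fs j) ≡ true → φ (fs i) ≡ φ (fs j) → i ≡ j
  inj′ i j p q e = fs-injective (inj (fs i) (fs j) p q e)

count-surjection : ∀ N M (P : Fin N → Bool) (Q : Fin M → Bool) (φ : Fin N → Fin M) →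
  (∀ i → P i ≡ true → Q (φ i) ≡ true) →
  (∀ i j → P i ≡ true → P j ≡ true → φ i ≡ φ j → i ≡ j) →
  count M Q ≤ count N P →
  ∀ y → Q y ≡ true → ∃ λ i → P i ≡ true × φ i ≡ y
count-surjection N M P Q φ into inj Q≤P y Qy
  with any? (λ i → (P i ≟ᵇ true) ×-dec (φ i ≟ y))
... | yes hit  = hit
... | no  miss = ⊥-elim (<⇒≱ P<Q Q≤P)
  where
  into′ : ∀ i → P i ≡ true → without Q y (φ i) ≡ true
  into′ i p rewrite into i p | dec-false (φ i ≟ y) (λ e → miss (i , p , e)) = refl
  P<Q : count N P < count M Q
  P<Q = subst (count N P <_) (sym (count-without M Q y Qy))
          (s≤s (count-injection N M P (without Q y) φ into′ inj))

count-witness : ∀ N (P : Fin N → Bool) → count N P ≢ 0 → ∃ λ i → P i ≡ true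
count-witness zero    P c≢0 = ⊥-elim (c≢0 refl)
count-witness (suc N) P c≢0 with P fz in P0
... | true  = fz , P0
... | false with count-witness N (P ∘ fs) c≢0
...   | i , Pi = fs i , Pi

count-positive : ∀ N (P : Fin N → Bool) i → P i ≡ true → count N P ≢ 0
count-positive (suc N) P i Pi c≡0 with trans (sym (count-punchIn-true N i P Pi)) c≡0
... | ()

count-allFalse : ∀ N (P : Fin N → Bool) → (∀ i → P i ≡ false) → count N P ≡ 0
count-allFalse zero    P none = refl
count-allFalse (suc N) P none rewrite none fz = count-allFalse N (P ∘ fs) (none ∘ fs)

count-split : ∀ N (P Q : Fin N → Bool) →
  count N P ≡ count N (λ i → P i ∧ Q i) + count N (λ i → P i ∧ not (Q i))
count-split zero    P Q = refl
count-split (suc N) P Q with P fz | Q fz | count-split N (P ∘ fs) (Q ∘ fs)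
... | false | _     | ih = ih
... | true  | true  | ih = cong suc ih
... | true  | false | ih = trans (cong suc ih) (sym (+-suc _ _))

count-+ : ∀ k l (P : Fin (k + l) → Bool) →
  count (k + l) P ≡ count k (P ∘ (_↑ˡ l)) + count l (P ∘ (k ↑ʳ_))
count-+ zero    l P = refl
count-+ (suc k) l P =
  trans (cong (indicator (P fz) +_) (count-+ k l (P ∘ fs))) (sym (+-assoc (indicator (P fz)) _ _))

count-* : ∀ m k (P : Fin (m * k) → Bool) → count (m * k) P ≡ sumFin m (λ i → count k (P ∘ combine i))
count-* zero    k P = refl
count-* (suc m) k P =
  trans (count-+ k (m * k) P) (cong (count k (P ∘ (_↑ˡ (m * k))) +_) (count-* m k (P ∘ (k ↑ʳ_))))

countList : {A : Set} → (A → Bool) → List A → ℕ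
countList P xs = length (filter (λ x → T? (P x)) xs)

countList-++ : {A : Set} (P : A → Bool) → ∀ xs ys → countList P (xs List.++ ys) ≡ countList P xs + countList P ys
countList-++ P []       ys = refl
countList-++ P (x ∷ xs) ys with P x
... | true  = cong suc (countList-++ P xs ys)
... | false = countList-++ P xs ys

countList-map : {A B : Set} (P : B → Bool) (h : A → B) → ∀ xs → countList P (List.map h xs) ≡ countList (P ∘ h) xs
countList-map P h []       = refl
countList-map P h (x ∷ xs) with P (h x)
... | true  = cong suc (countList-map P h xs)
... | false = countList-map P h xs

countList-concatMap : {A B : Set} (P : B → Bool) → ∀ N (g : Fin N → A) (f : A → List B) →
  countList P (concatMap f (List.tabulate g)) ≡ sumFin N (λ i → countList P (f (g i)))
countList-concatMap P zero    g f = refl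
countList-concatMap P (suc N) g f =
  trans (countList-++ P (f (g fz)) _) (cong (countList P (f (g fz)) +_) (countList-concatMap P N (g ∘ fs) f))

countVec : ∀ m n → (Vec (Fin m) n → Bool) → ℕ
countVec m n P = countList P (allVecs m n)

countVec-suc : ∀ m n P → countVec m (suc n) P ≡ sumFin m (λ x → countVec m n (P ∘ (x ∷_)))
countVec-suc m n P =
  trans (countList-concatMap P m id (λ x → List.map (x ∷_) (allVecs m n)))
        (sumFin-cong m (λ x → countList-map P (x ∷_) (allVecs m n)))

-- Tuples of length n over Fin m are coded by Fin (m ^ n) (base-m digits).
decode : ∀ {m} n → Fin (m ^ n) → Vec (Fin m) n
decode zero    _ = []
decode {m} (suc n) i = proj₁ (remQuot {m} (m ^ n) i) ∷ decode n (proj₂ (remQuot {m} (m ^ n) i))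

encode : ∀ {m n} → Vec (Fin m) n → Fin (m ^ n)
encode []      = fz
encode (x ∷ v) = combine x (encode v)

decode-combine : ∀ {m} n (x : Fin m) (j : Fin (m ^ n)) → decode (suc n) (combine x j) ≡ x ∷ decode n j
decode-combine {m} n x j = cong (λ r → proj₁ r ∷ decode n (proj₂ r)) (remQuot-combine {k = m ^ n} x j)

decode-encode : ∀ {m n} (v : Vec (Fin m) n) → decode n (encode v) ≡ v
decode-encode []      = refl
decode-encode {m} {suc n} (x ∷ v) = trans (decode-combine n x (encode v)) (cong (x ∷_) (decode-encode v))

encode-decode : ∀ {m} n (i : Fin (m ^ n)) → encode (decode n i) ≡ i
encode-decode zero fz = refl
encode-decode {m} (suc n) i =
  trans (cong (combine (proj₁ (remQuot {m} (m ^ n) i))) (encode-decode n (proj₂ (remQuot {m} (m ^ n) i))))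
        (combine-remQuot {m} (m ^ n) i)

encode-injective : ∀ {m n} {u v : Vec (Fin m) n} → encode u ≡ encode v → u ≡ v
encode-injective {n = n} {u} {v} e = trans (sym (decode-encode u)) (trans (cong (decode n) e) (decode-encode v))

decode-injective : ∀ {m} n {i j : Fin (m ^ n)} → decode n i ≡ decode n j → i ≡ j
decode-injective n {i} {j} e = trans (sym (encode-decode n i)) (trans (cong encode e) (encode-decode n j))

countVec≡count : ∀ m n P → countVec m n P ≡ count (m ^ n) (P ∘ decode n)
countVec≡count m zero P with P []
... | true  = refl
... | false = refl
countVec≡count m (suc n) P = begin
  countVec m (suc n) P                                   ≡⟨ countVec-suc m n P ⟩
  sumFin m (λ x → countVec m n (P ∘ (x ∷_)))             ≡⟨ sumFin-cong m digit ⟩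
  sumFin m (λ x → count (m ^ n) (P ∘ decode (suc n) ∘ combine x))
                                                         ≡⟨ count-* m (m ^ n) (P ∘ decode (suc n)) ⟨
  count (m ^ suc n) (P ∘ decode (suc n))                 ∎
  where
  open ≡-Reasoning
  digit : ∀ x → countVec m n (P ∘ (x ∷_)) ≡ count (m ^ n) (P ∘ decode (suc n) ∘ combine x)
  digit x = trans (countVec≡count m n (P ∘ (x ∷_)))
                  (count-cong (m ^ n) (λ j → cong P (sym (decode-combine n x j))))

module _ {m n : ℕ} where

  countVec-cong : {P Q : Vec (Fin m) n → Bool} → (∀ v → P v ≡ Q v) → countVec m n P ≡ countVec m n Q
  countVec-cong {P} {Q} e =
    trans (countVec≡count m n P) (trans (count-cong _ (e ∘ decode n)) (sym (countVec≡count m n Q)))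

  countVec-split : (P Q : Vec (Fin m) n → Bool) →
    countVec m n P ≡ countVec m n (λ v → P v ∧ Q v) + countVec m n (λ v → P v ∧ not (Q v))
  countVec-split P Q =
    trans (countVec≡count m n P) (trans (count-split _ (P ∘ decode n) (Q ∘ decode n))
          (sym (cong₂ _+_ (countVec≡count m n _) (countVec≡count m n _))))

  countVec-witness : (P : Vec (Fin m) n → Bool) → countVec m n P ≢ 0 → ∃ λ v → P v ≡ true
  countVec-witness P c≢0 with count-witness (m ^ n) (P ∘ decode n) (c≢0 ∘ trans (countVec≡count m n P))
  ... | i , Pi = decode n i , Pi

  countVec-positive : (P : Vec (Fin m) n → Bool) → ∀ v → P v ≡ true → countVec m n P ≢ 0
  countVec-positive P v Pv c≡0 =
    count-positive (m ^ n) (P ∘ decode n) (encode v) (trans (cong P (decode-encode v)) Pv)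
      (trans (sym (countVec≡count m n P)) c≡0)

  countVec-allFalse : (P : Vec (Fin m) n → Bool) → (∀ v → P v ≡ false) → countVec m n P ≡ 0
  countVec-allFalse P none = trans (countVec≡count m n P) (count-allFalse _ _ (none ∘ decode n))

module _ {m n m′ n′ : ℕ} (P : Vec (Fin m) n → Bool) (Q : Vec (Fin m′) n′ → Bool)
         (φ : Vec (Fin m) n → Vec (Fin m′) n′)
         (into : ∀ v → P v ≡ true → Q (φ v) ≡ true)
         (inj : ∀ v w → P v ≡ true → P w ≡ true → φ v ≡ φ w → v ≡ w) where

  private
    φ̂ : Fin (m ^ n) → Fin (m′ ^ n′)
    φ̂ = encode ∘ φ ∘ decode n
    intô : ∀ i → P (decode n i) ≡ true → Q (decode n′ (φ̂ i)) ≡ true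
    intô i p = trans (cong Q (decode-encode _)) (into _ p)
    inĵ : ∀ i j → P (decode n i) ≡ true → P (decode n j) ≡ true → φ̂ i ≡ φ̂ j → i ≡ j
    inĵ i j p q e = decode-injective n (inj _ _ p q (encode-injective e))

  countVec-injection : countVec m n P ≤ countVec m′ n′ Q
  countVec-injection = subst₂ _≤_ (sym (countVec≡count m n P)) (sym (countVec≡count m′ n′ Q))
    (count-injection _ _ (P ∘ decode n) (Q ∘ decode n′) φ̂ intô inĵ)

  countVec-surjection : countVec m′ n′ Q ≤ countVec m n P →
    ∀ w → Q w ≡ true → ∃ λ v → P v ≡ true × φ v ≡ w
  countVec-surjection Q≤P w Qw
    with count-surjection _ _ (P ∘ decode n) (Q ∘ decode n′) φ̂ intô inĵ
           (subst₂ _≤_ (countVec≡count m′ n′ Q) (countVec≡count m n P) Q≤P)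
           (encode w) (trans (cong Q (decode-encode w)) Qw)
  ... | i , Pi , e = decode n i , Pi , encode-injective e

countVec-bijection : ∀ {m n m′ n′} (P : Vec (Fin m) n → Bool) (Q : Vec (Fin m′) n′ → Bool)
  (φ : Vec (Fin m) n → Vec (Fin m′) n′) (ψ : Vec (Fin m′) n′ → Vec (Fin m) n) →
  (∀ v → P v ≡ true → Q (φ v) ≡ true) → (∀ w → Q w ≡ true → P (ψ w) ≡ true) →
  (∀ v → P v ≡ true → ψ (φ v) ≡ v) → (∀ w → Q w ≡ true → φ (ψ w) ≡ w) →
  countVec m n P ≡ countVec m′ n′ Q
countVec-bijection P Q φ ψ φ-into ψ-into ψφ φψ = ≤-antisym
  (countVec-injection P Q φ φ-into (λ v w p q e → trans (sym (ψφ v p)) (trans (cong ψ e) (ψφ w q))))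
  (countVec-injection Q P ψ ψ-into (λ v w p q e → trans (sym (φψ v p)) (trans (cong φ e) (φψ w q))))

all-sound : {A : Set} (p : A → Bool) → ∀ xs → all p xs ≡ true → ∀ {x} → x ∈ xs → p x ≡ true
all-sound p xs e x∈ = to T-≡ (All.lookup (all⁺ p xs (from T-≡ e)) x∈)

all-complete : {A : Set} (p : A → Bool) → ∀ xs → (∀ {x} → x ∈ xs → p x ≡ true) → all p xs ≡ true
all-complete p xs h = to T-≡ (all⁻ p (All.tabulate (from T-≡ ∘ h)))

∈-allVecs : ∀ m k (v : Vec (Fin m) k) → v ∈ allVecs m k
∈-allVecs m zero    []      = Any.here refl
∈-allVecs m (suc k) (x ∷ v) =
  ∈-concatMap⁺ _ (Any.map (λ { refl → ∈-map⁺ (x ∷_) (∈-allVecs m k v) }) (∈-allFin x))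

does-true : {A : Set} (d : Dec A) → does d ≡ true → A
does-true (yes a) _ = a

Bool-ext : ∀ {x y} → (x ≡ true → y ≡ true) → (y ≡ true → x ≡ true) → x ≡ y
Bool-ext {false} {false} _ _ = refl
Bool-ext {false} {true}  _ y⇒x = y⇒x refl
Bool-ext {true}  {_}     x⇒y _ = sym (x⇒y refl)

implies-elim : ∀ {a b} → implies a b ≡ true → a ≡ true → b ≡ true
implies-elim e refl = e

implies-intro : ∀ a {b} → (a ≡ true → b ≡ true) → implies a b ≡ true
implies-intro true  h = h refl
implies-intro false h = refl

module _ {σ : Signature} where

  preserves : (A B : Structure σ) → Vec (Fin (size B)) (size A) →
    (R : Fin (nsym σ)) → Vec (Fin (size A)) (ar σ R) → Bool
  preserves A B f R t = implies (rel A R t) (rel B R (vmap (lookup f) t))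

  isHom?-sound : (A B : Structure σ) (f : Vec (Fin (size B)) (size A)) → isHom? A B f ≡ true → IsHom A B (lookup f)
  isHom?-sound A B f e R t = implies-elim (all-sound (preserves A B f R) _ at-R (∈-allVecs _ _ t))
    where
    at-R = all-sound (λ R → all (preserves A B f R) (allVecs (size A) (ar σ R))) _ e (∈-allFin R)

  isHom?-complete : (A B : Structure σ) (f : Vec (Fin (size B)) (size A)) → IsHom A B (lookup f) → isHom? A B f ≡ true
  isHom?-complete A B f h = all-complete (λ R → all (preserves A B f R) (allVecs (size A) (ar σ R))) (allFin _)
    λ {R} _ → all-complete (preserves A B f R) (allVecs (size A) (ar σ R))
      λ {t} _ → implies-intro (rel A R t) (h R t)

  IsHom-cong : (A B : Structure σ) {g h : Fin (size A) → Fin (size B)} →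
    (∀ x → g x ≡ h x) → IsHom A B g → IsHom A B h
  IsHom-cong A B g≗h hom R t e = subst (λ u → rel B R u ≡ true) (map-cong g≗h t) (hom R t e)

  IsHom-∘ : (A B C : Structure σ) {g : Fin (size A) → Fin (size B)} {h : Fin (size B) → Fin (size C)} →
    IsHom A B g → IsHom B C h → IsHom A C (h ∘ g)
  IsHom-∘ A B C {g} {h} hg hh R t e = subst (λ u → rel C R u ≡ true) (sym (map-∘ h g t)) (hh R (vmap g t) (hg R t e))

  Hom≢0⇒hom : (A B : Structure σ) → Hom A B ≢ 0 → Σ (Fin (size A) → Fin (size B)) (IsHom A B)
  Hom≢0⇒hom A B ne with countVec-witness (isHom? A B) ne
  ... | f , e = lookup f , isHom?-sound A B f e

  hom⇒Hom≢0 : (A B : Structure σ) (g : Fin (size A) → Fin (size B)) → IsHom A B g → Hom A B ≢ 0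
  hom⇒Hom≢0 A B g hom = countVec-positive (isHom? A B) (tabulate g)
    (isHom?-complete A B (tabulate g) (IsHom-cong A B (λ x → sym (lookup∘tabulate g x)) hom))

anyVec : ∀ m k → (Vec (Fin m) k → Bool) → Bool
anyVec m k P = any P (allVecs m k)

anyVec-witness : ∀ {m k} (P : Vec (Fin m) k → Bool) → anyVec m k P ≡ true → ∃ λ v → P v ≡ true
anyVec-witness {m} {k} P e with Any.satisfied (any⁻ P (allVecs m k) (from T-≡ e))
... | v , Pv = v , to T-≡ Pv

anyVec-intro : ∀ {m k} (P : Vec (Fin m) k → Bool) v → P v ≡ true → anyVec m k P ≡ true
anyVec-intro P v Pv = to T-≡ (any⁺ P (lose (∈-allVecs _ _ v) (from T-≡ Pv)))

image : ∀ {n n′ k} → (Fin n → Fin n′) → (Vec (Fin n) k → Bool) → Vec (Fin n′) k → Bool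
image {n} {k = k} q r t = anyVec n k (λ s → does (≡-dec _≟_ (vmap q s) t) ∧ r s)

image-intro : ∀ {n n′ k} (q : Fin n → Fin n′) (r : Vec (Fin n) k → Bool) s →
  r s ≡ true → image q r (vmap q s) ≡ true
image-intro q r s rs = anyVec-intro _ s (cong₂ _∧_ (dec-true (≡-dec _≟_ (vmap q s) (vmap q s)) refl) rs)

image-preserved : ∀ {n n′ m k} (q : Fin n → Fin n′) (r : Vec (Fin n) k → Bool) (r′ : Vec (Fin m) k → Bool)
  (g : Fin n′ → Fin m) → (∀ s → r s ≡ true → r′ (vmap (g ∘ q) s) ≡ true) →
  ∀ t → image q r t ≡ true → r′ (vmap g t) ≡ true
image-preserved q r r′ g pres t e with anyVec-witness _ e
... | s , found = subst (λ u → r′ (vmap g u) ≡ true) (does-true (≡-dec _≟_ (vmap q s) t) (∧-conicalˡ _ _ found))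
                    (subst (λ u → r′ u ≡ true) (map-∘ g q s) (pres s (∧-conicalʳ _ _ found)))

countVec-++ : ∀ m n₁ n₂ (F : Vec (Fin m) (n₁ + n₂) → Bool) (P : Vec (Fin m) n₁ → Bool) (Q : Vec (Fin m) n₂ → Bool) →
  (∀ v₁ v₂ → F (v₁ ++ v₂) ≡ P v₁ ∧ Q v₂) →
  countVec m (n₁ + n₂) F ≡ countVec m n₁ P * countVec m n₂ Q
countVec-++ m zero n₂ F P Q split with P [] in P[]
... | true  = trans (countVec-cong (λ v → trans (split [] v) (cong (_∧ Q v) P[]))) (sym (+-identityʳ _))
... | false = countVec-allFalse F (λ v → trans (split [] v) (cong (_∧ Q v) P[]))
countVec-++ m (suc n₁) n₂ F P Q split = begin
  countVec m (suc n₁ + n₂) F                                          ≡⟨ countVec-suc m (n₁ + n₂) F ⟩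
  sumFin m (λ x → countVec m (n₁ + n₂) (F ∘ (x ∷_)))                  ≡⟨ sumFin-cong m (λ x →
                    countVec-++ m n₁ n₂ (F ∘ (x ∷_)) (P ∘ (x ∷_)) Q (λ v₁ v₂ → split (x ∷ v₁) v₂)) ⟩
  sumFin m (λ x → countVec m n₁ (P ∘ (x ∷_)) * countVec m n₂ Q)       ≡⟨ sumFin-*ʳ m _ (countVec m n₂ Q) ⟨
  sumFin m (λ x → countVec m n₁ (P ∘ (x ∷_))) * countVec m n₂ Q
                                                  ≡⟨ cong (_* countVec m n₂ Q) (countVec-suc m n₁ P) ⟨
  countVec m (suc n₁) P * countVec m n₂ Q                             ∎
  where open ≡-Reasoning

module _ {σ : Signature} where

  _⊕_ : Structure σ → Structure σ → Structure σ
  A₁ ⊕ A₂ = record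
    { size = size A₁ + size A₂
    ; rel  = λ R t → image (_↑ˡ size A₂) (rel A₁ R) t ∨ image (size A₁ ↑ʳ_) (rel A₂ R) t
    }

  ⊕-hom⁻ : (A₁ A₂ B : Structure σ) (g : Fin (size A₁ + size A₂) → Fin (size B)) → IsHom (A₁ ⊕ A₂) B g →
    IsHom A₁ B (g ∘ (_↑ˡ size A₂)) × IsHom A₂ B (g ∘ (size A₁ ↑ʳ_))
  ⊕-hom⁻ A₁ A₂ B g hom = left , right
    where
    left : IsHom A₁ B (g ∘ (_↑ˡ size A₂))
    left R s rs = subst (λ u → rel B R u ≡ true) (sym (map-∘ g _ s))
      (hom R (vmap (_↑ˡ size A₂) s) (cong (_∨ image (size A₁ ↑ʳ_) (rel A₂ R) (vmap (_↑ˡ size A₂) s))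
                                           (image-intro _ (rel A₁ R) s rs)))
    right : IsHom A₂ B (g ∘ (size A₁ ↑ʳ_))
    right R s rs = subst (λ u → rel B R u ≡ true) (sym (map-∘ g _ s))
      (hom R (vmap (size A₁ ↑ʳ_) s) (trans (cong (image (_↑ˡ size A₂) (rel A₁ R) (vmap (size A₁ ↑ʳ_) s) ∨_)
                                                   (image-intro _ (rel A₂ R) s rs)) (∨-zeroʳ _)))

  ⊕-hom⁺ : (A₁ A₂ B : Structure σ) (g : Fin (size A₁ + size A₂) → Fin (size B)) →
    IsHom A₁ B (g ∘ (_↑ˡ size A₂)) → IsHom A₂ B (g ∘ (size A₁ ↑ʳ_)) → IsHom (A₁ ⊕ A₂) B g
  ⊕-hom⁺ A₁ A₂ B g hom₁ hom₂ R t rt with image (_↑ˡ size A₂) (rel A₁ R) t in inLeft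
  ... | true  = image-preserved _ (rel A₁ R) (rel B R) g (hom₁ R) t inLeft
  ... | false = image-preserved _ (rel A₂ R) (rel B R) g (hom₂ R) t rt

  Hom-⊕ : (A₁ A₂ B : Structure σ) → Hom (A₁ ⊕ A₂) B ≡ Hom A₁ B * Hom A₂ B
  Hom-⊕ A₁ A₂ B =
    countVec-++ (size B) (size A₁) (size A₂) (isHom? (A₁ ⊕ A₂) B) (isHom? A₁ B) (isHom? A₂ B) split
    where
    split : ∀ v₁ v₂ → isHom? (A₁ ⊕ A₂) B (v₁ ++ v₂) ≡ isHom? A₁ B v₁ ∧ isHom? A₂ B v₂
    split v₁ v₂ = Bool-ext
      (λ e → let homs = ⊕-hom⁻ A₁ A₂ B _ (isHom?-sound (A₁ ⊕ A₂) B (v₁ ++ v₂) e) in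
        cong₂ _∧_ (isHom?-complete A₁ B v₁ (IsHom-cong A₁ B (lookup-++ˡ v₁ v₂) (proj₁ homs)))
                  (isHom?-complete A₂ B v₂ (IsHom-cong A₂ B (lookup-++ʳ v₁ v₂) (proj₂ homs))))
      (λ e → isHom?-complete (A₁ ⊕ A₂) B (v₁ ++ v₂) (⊕-hom⁺ A₁ A₂ B _
        (IsHom-cong A₁ B (sym ∘ lookup-++ˡ v₁ v₂) (isHom?-sound A₁ B v₁ (∧-conicalˡ _ _ e)))
        (IsHom-cong A₂ B (sym ∘ lookup-++ʳ v₁ v₂) (isHom?-sound A₂ B v₂ (∧-conicalʳ _ _ e)))))

  empty : Structure σ
  empty = record { size = 0 ; rel = λ _ _ → false }

  Hom-empty : (B : Structure σ) → Hom empty B ≡ 1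
  Hom-empty B with isHom? empty B [] | isHom?-complete empty B [] (λ R t ())
  ... | true | refl = refl

  power : Structure σ → ℕ → Structure σ
  power A zero    = empty
  power A (suc t) = A ⊕ power A t

  Hom-power : (A B : Structure σ) (t : ℕ) → Hom (power A t) B ≡ Hom A B ^ t
  Hom-power A B zero    = Hom-empty B
  Hom-power A B (suc t) = trans (Hom-⊕ A (power A t) B) (cong (Hom A B *_) (Hom-power A B t))

-- Bernoulli's inequality (1 + 1/a)^t ≥ 1 + t/a, cleared of denominators.
bernoulli : ∀ a t → a ^ t * (a + t) ≤ a * suc a ^ t
bernoulli a zero    = ≤-reflexive (base a)
  where
  base : ∀ a → 1 * (a + 0) ≡ a * 1
  base = solve-∀
bernoulli a (suc t) = begin
  a * a ^ t * (a + suc t)                      ≤⟨ m≤m+n _ _ ⟩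
  a * a ^ t * (a + suc t) + a ^ t * t          ≡⟨ expand a (a ^ t) t ⟨
  suc a * (a ^ t * (a + t))                    ≤⟨ *-monoʳ-≤ (suc a) (bernoulli a t) ⟩
  suc a * (a * suc a ^ t)                      ≡⟨ swap a (suc a ^ t) ⟩
  a * (suc a * suc a ^ t)                      ∎
  where
  open ≤-Reasoning
  expand : ∀ a X t → suc a * (X * (a + t)) ≡ a * X * (a + suc t) + X * t
  expand = solve-∀
  swap : ∀ a Y → suc a * (a * Y) ≡ a * (suc a * Y)
  swap = solve-∀

power-gap : ∀ a c t → 1 ≤ a → a * c ≤ t → a ^ t * c < suc a ^ t
power-gap a c t a≥1 ac≤t = begin-strict
  a ^ t * c              <⟨ +-monoˡ-< (a ^ t * c) (m^n>0 a t) ⟩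
  a ^ t + a ^ t * c      ≡⟨ *-suc (a ^ t) c ⟨
  a ^ t * suc c          ≤⟨ *-cancelˡ-≤ a scaled ⟩
  suc a ^ t              ∎
  where
  open ≤-Reasoning
  instance _ = >-nonZero a≥1
  distribute : ∀ a X c → a * (X * suc c) ≡ X * (a + a * c)
  distribute = solve-∀
  scaled : a * (a ^ t * suc c) ≤ a * suc a ^ t
  scaled = begin
    a * (a ^ t * suc c)     ≡⟨ distribute a (a ^ t) c ⟩
    a ^ t * (a + a * c)     ≤⟨ *-monoʳ-≤ (a ^ t) (+-monoʳ-≤ a ac≤t) ⟩
    a ^ t * (a + t)         ≤⟨ bernoulli a t ⟩
    a * suc a ^ t           ∎

power-separates : ∀ a b c d t → 1 ≤ a → a < b → a * c ≤ t → 1 ≤ d → a ^ t * c < b ^ t * d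
power-separates a b c d t a≥1 a<b ac≤t d≥1 = begin-strict
  a ^ t * c         <⟨ power-gap a c t a≥1 ac≤t ⟩
  suc a ^ t         ≤⟨ ^-monoˡ-≤ t a<b ⟩
  b ^ t             ≡⟨ *-identityʳ (b ^ t) ⟨
  b ^ t * 1         ≤⟨ *-monoʳ-≤ (b ^ t) d≥1 ⟩
  b ^ t * d         ∎
  where open ≤-Reasoning

vec-ext : ∀ {A : Set} {n} {u v : Vec A n} → (∀ i → lookup u i ≡ lookup v i) → u ≡ v
vec-ext {u = u} {v} h = trans (sym (tabulate∘lookup u)) (trans (tabulate-cong h) (tabulate∘lookup v))

-- collapse b a : Fin (suc n) → Fin n sends b to a and is the inverse of punchIn b elsewhere;
-- it identifies b with punchIn b a.
collapse : ∀ {n} → Fin (suc n) → Fin n → Fin (suc n) → Fin n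
collapse b a x with x ≟ b
... | yes _   = a
... | no  x≢b = punchOut (x≢b ∘ sym)

collapse-b : ∀ {n} (b : Fin (suc n)) a → collapse b a b ≡ a
collapse-b b a with b ≟ b
... | yes _   = refl
... | no  b≢b = ⊥-elim (b≢b refl)

collapse-punchIn : ∀ {n} (b : Fin (suc n)) a y → collapse b a (punchIn b y) ≡ y
collapse-punchIn b a y with punchIn b y ≟ b
... | yes e = ⊥-elim (punchInᵢ≢i b y e)
... | no  _ = trans (punchOut-cong′ b refl) (punchOut-punchIn b)

punchIn-collapse : ∀ {n} (b : Fin (suc n)) a x → x ≢ b → punchIn b (collapse b a x) ≡ x
punchIn-collapse b a x x≢b with x ≟ b
... | yes e = ⊥-elim (x≢b e)
... | no  _ = punchIn-punchOut _

separates : ∀ {m n} → Vec (Fin m) n → List (Fin n × Fin n) → Bool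
separates f []            = true
separates f ((c , d) ∷ E) = not (does (lookup f c ≟ lookup f d)) ∧ separates f E

separates-map : ∀ {m n n′} (f : Vec (Fin m) n) (g : Vec (Fin m) n′) (q : Fin n → Fin n′) →
  (∀ x → lookup f x ≡ lookup g (q x)) → ∀ E → separates f E ≡ separates g (List.map (λ (c , d) → q c , q d) E)
separates-map f g q f≗gq []            = refl
separates-map f g q f≗gq ((c , d) ∷ E) =
  trans (cong₂ (λ u v → not (does (u ≟ v)) ∧ separates f E) (f≗gq c) (f≗gq d))
        (cong (_ ∧_) (separates-map f g q f≗gq E))

module _ {σ : Signature} where

  Relations : ℕ → Set
  Relations n = (R : Fin (nsym σ)) → Vec (Fin n) (ar σ R) → Bool

  structure : (n : ℕ) → Relations n → Structure σ
  structure n r = record { size = n ; rel = r }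

  merge : ∀ {n} → Relations (suc n) → Fin (suc n) → Fin n → Relations n
  merge r b a R = image (collapse b a) (r R)

  HomSep : (C T : Structure σ) → List (Fin (size C) × Fin (size C)) → ℕ
  HomSep C T E = countVec (size T) (size C) (λ f → isHom? C T f ∧ separates f E)

  module Merging {n : ℕ} (r : Relations (suc n)) (b : Fin (suc n)) (a : Fin n) (T : Structure σ) where

    C C/ : Structure σ
    C  = structure (suc n) r
    C/ = structure n (merge r b a)

    a′ : Fin (suc n)
    a′ = punchIn b a

    q : Fin (suc n) → Fin n
    q = collapse b a

    Pairs/ : List (Fin (suc n) × Fin (suc n)) → List (Fin n × Fin n)
    Pairs/ = List.map (λ (c , d) → q c , q d)

    -- Maps on C/ are maps on C that agree at a′ and b.
    restrict : Vec (Fin (size T)) (suc n) → Vec (Fin (size T)) n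
    restrict f = tabulate (lookup f ∘ punchIn b)

    extend : Vec (Fin (size T)) n → Vec (Fin (size T)) (suc n)
    extend g = tabulate (lookup g ∘ q)

    identifies : Vec (Fin (size T)) (suc n) → Bool
    identifies f = does (lookup f a′ ≟ lookup f b)

    factors : ∀ f → lookup f a′ ≡ lookup f b → ∀ x → lookup f x ≡ lookup (restrict f) (q x)
    factors f e x = trans (through-q (x ≟ b)) (sym (lookup∘tabulate (lookup f ∘ punchIn b) (q x)))
      where
      through-q : Dec (x ≡ b) → lookup f x ≡ lookup f (punchIn b (q x))
      through-q (yes refl) = trans (sym e) (cong (lookup f ∘ punchIn b) (sym (collapse-b b a)))
      through-q (no x≢b)   = cong (lookup f) (sym (punchIn-collapse b a x x≢b))

    extend-lookup : ∀ g x → lookup (extend g) x ≡ lookup g (q x)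
    extend-lookup g = lookup∘tabulate (lookup g ∘ q)

    restrict-extend : ∀ g → restrict (extend g) ≡ g
    restrict-extend g = vec-ext λ y →
      trans (lookup∘tabulate _ y) (trans (extend-lookup g (punchIn b y)) (cong (lookup g) (collapse-punchIn b a y)))

    extend-restrict : ∀ f → lookup f a′ ≡ lookup f b → extend (restrict f) ≡ f
    extend-restrict f e = vec-ext λ x → trans (extend-lookup (restrict f) x) (sym (factors f e x))

    extend-identifies : ∀ g → lookup (extend g) a′ ≡ lookup (extend g) b
    extend-identifies g = trans (extend-lookup g a′)
      (trans (cong (lookup g) (trans (collapse-punchIn b a a) (sym (collapse-b b a)))) (sym (extend-lookup g b)))

    restrict-hom : ∀ f → IsHom C T (lookup f) → lookup f a′ ≡ lookup f b → IsHom C/ T (lookup (restrict f))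
    restrict-hom f hom e R = image-preserved q (r R) (rel T R) (lookup (restrict f))
      (λ s rs → subst (λ u → rel T R u ≡ true) (map-cong (factors f e) s) (hom R s rs))

    extend-hom : ∀ g → IsHom C/ T (lookup g) → IsHom C T (lookup (extend g))
    extend-hom g hom = IsHom-cong C T (λ x → sym (extend-lookup g x))
      λ R s rs → subst (λ u → rel T R u ≡ true) (sym (map-∘ (lookup g) q s))
                   (hom R (vmap q s) (image-intro q (r R) s rs))

    HomIdentifying : List (Fin (suc n) × Fin (suc n)) → Vec (Fin (size T)) (suc n) → Bool
    HomIdentifying E f = (isHom? C T f ∧ separates f E) ∧ identifies f

    HomSep-identified : ∀ E → countVec (size T) (suc n) (HomIdentifying E) ≡ HomSep C/ T (Pairs/ E)
    HomSep-identified E = countVec-bijection _ _ restrict extend into-C/ into-C extend-restrict′ (λ g _ → restrict-extend g)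
      where
      identified : ∀ {f} → HomIdentifying E f ≡ true → lookup f a′ ≡ lookup f b
      identified {f} p = does-true (lookup f a′ ≟ lookup f b) (∧-conicalʳ (isHom? C T f ∧ separates f E) _ p)
      into-C/ : ∀ f → HomIdentifying E f ≡ true → isHom? C/ T (restrict f) ∧ separates (restrict f) (Pairs/ E) ≡ true
      into-C/ f p = cong₂ _∧_ (isHom?-complete C/ T (restrict f) (restrict-hom f (isHom?-sound C T f hom) (identified p)))
                              (trans (sym (separates-map f (restrict f) q (factors f (identified p)) E)) sep)
        where
        homSep = ∧-conicalˡ (isHom? C T f ∧ separates f E) (identifies f) p
        hom    = ∧-conicalˡ (isHom? C T f) (separates f E) homSep
        sep    = ∧-conicalʳ (isHom? C T f) (separates f E) homSep
      into-C : ∀ g → isHom? C/ T g ∧ separates g (Pairs/ E) ≡ true → HomIdentifying E (extend g) ≡ true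
      into-C g p = cong₂ _∧_
        (cong₂ _∧_ (isHom?-complete C T (extend g) (extend-hom g (isHom?-sound C/ T g (∧-conicalˡ (isHom? C/ T g) _ p))))
                   (trans (separates-map (extend g) g q (extend-lookup g) E) (∧-conicalʳ (isHom? C/ T g) _ p)))
        (dec-true (lookup (extend g) a′ ≟ lookup (extend g) b) (extend-identifies g))
      extend-restrict′ : ∀ f → HomIdentifying E f ≡ true → extend (restrict f) ≡ f
      extend-restrict′ f p = extend-restrict f (identified p)

    -- Deletion–contraction: homomorphisms either separate a′ and b, or factor through C/.
    HomSep-merge : ∀ E → HomSep C T E ≡ HomSep C T ((a′ , b) ∷ E) + HomSep C/ T (Pairs/ E)
    HomSep-merge E = begin
      HomSep C T E                                          ≡⟨ countVec-split P identifies ⟩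
      countVec _ _ (HomIdentifying E) + countVec _ _ (λ f → P f ∧ not (identifies f))
                                                            ≡⟨ cong₂ _+_ (HomSep-identified E) (countVec-cong separating) ⟩
      HomSep C/ T (Pairs/ E) + HomSep C T ((a′ , b) ∷ E)    ≡⟨ +-comm (HomSep C/ T (Pairs/ E)) _ ⟩
      HomSep C T ((a′ , b) ∷ E) + HomSep C/ T (Pairs/ E)    ∎
      where
      open ≡-Reasoning
      P : Vec (Fin (size T)) (suc n) → Bool
      P f = isHom? C T f ∧ separates f E
      rearrange : ∀ x y z → (x ∧ y) ∧ not z ≡ x ∧ (not z ∧ y)
      rearrange false y     z = refl
      rearrange true  false z = sym (∧-zeroʳ (not z))
      rearrange true  true  z = sym (∧-identityʳ (not z))
      separating : ∀ f → P f ∧ not (identifies f) ≡ isHom? C T f ∧ separates f ((a′ , b) ∷ E)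
      separating f = rearrange (isHom? C T f) (separates f E) (identifies f)

  HomSep-[] : (C T : Structure σ) → HomSep C T [] ≡ Hom C T
  HomSep-[] C T = countVec-cong (λ f → ∧-identityʳ (isHom? C T f))

  HomSep-diagonal : (C T : Structure σ) (c : Fin (size C)) → ∀ E → HomSep C T ((c , c) ∷ E) ≡ 0
  HomSep-diagonal C T c E = countVec-allFalse _ λ f →
    trans (cong (λ z → isHom? C T f ∧ (not z ∧ separates f E)) (dec-true (lookup f c ≟ lookup f c) refl))
          (∧-zeroʳ (isHom? C T f))

  module Agreement (T₁ T₂ : Structure σ) where

    Agree : (n : ℕ) → Relations n → Set
    Agree zero    r = Hom (structure zero r) T₁ ≡ Hom (structure zero r) T₂
    Agree (suc n) r = Hom (structure (suc n) r) T₁ ≡ Hom (structure (suc n) r) T₂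
                    × (∀ b a → Agree n (merge r b a))

    agree? : ∀ n r → Dec (Agree n r)
    agree? zero    r = Hom (structure zero r) T₁ ≟ℕ Hom (structure zero r) T₂
    agree? (suc n) r = (Hom (structure (suc n) r) T₁ ≟ℕ Hom (structure (suc n) r) T₂)
                       ×-dec all? (λ b → all? (λ a → agree? n (merge r b a)))

    disagreement : ∀ n r → ¬ Agree n r → Σ (Structure σ) λ D → Hom D T₁ ≢ Hom D T₂
    disagreement zero    r ¬agree = structure zero r , ¬agree
    disagreement (suc n) r ¬agree with Hom (structure (suc n) r) T₁ ≟ℕ Hom (structure (suc n) r) T₂
    ... | no  differ = structure (suc n) r , differ
    ... | yes same
      with ¬∀⟶∃¬ (suc n) _ (λ b → all? (λ a → agree? n (merge r b a))) (λ below → ¬agree (same , below))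
    ...   | b , ¬agree-b with ¬∀⟶∃¬ n _ (λ a → agree? n (merge r b a)) ¬agree-b
    ...     | a , ¬agree-ba = disagreement n (merge r b a) ¬agree-ba

    HomSep-cons : ∀ {n} (r : Relations (suc n)) c d E →
      HomSep (structure (suc n) r) T₁ E ≡ HomSep (structure (suc n) r) T₂ E →
      (∀ b a E′ → HomSep (structure n (merge r b a)) T₁ E′ ≡ HomSep (structure n (merge r b a)) T₂ E′) →
      HomSep (structure (suc n) r) T₁ ((c , d) ∷ E) ≡ HomSep (structure (suc n) r) T₂ ((c , d) ∷ E)
    HomSep-cons r c d E fewer quotients with c ≟ d
    ... | yes refl = trans (HomSep-diagonal (structure _ r) T₁ c E) (sym (HomSep-diagonal (structure _ r) T₂ c E))
    ... | no  c≢d  = subst (λ x → HomSep C T₁ ((x , d) ∷ E) ≡ HomSep C T₂ ((x , d) ∷ E)) (punchIn-punchOut d≢c)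
                       (+-cancelʳ-≡ _ _ _ (begin
        HomSep C T₁ ((M₁.a′ , d) ∷ E) + HomSep M₁.C/ T₁ (M₁.Pairs/ E)   ≡⟨ M₁.HomSep-merge E ⟨
        HomSep C T₁ E                                                   ≡⟨ fewer ⟩
        HomSep C T₂ E                                                   ≡⟨ M₂.HomSep-merge E ⟩
        HomSep C T₂ ((M₁.a′ , d) ∷ E) + HomSep M₁.C/ T₂ (M₁.Pairs/ E)   ≡⟨ cong (HomSep C T₂ ((M₁.a′ , d) ∷ E) +_) quotient ⟨
        HomSep C T₂ ((M₁.a′ , d) ∷ E) + HomSep M₁.C/ T₁ (M₁.Pairs/ E)   ∎))
      where
      open ≡-Reasoning
      d≢c = c≢d ∘ sym
      C = structure _ r
      module M₁ = Merging r d (punchOut d≢c) T₁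
      module M₂ = Merging r d (punchOut d≢c) T₂
      quotient = quotients d (punchOut d≢c) (M₁.Pairs/ E)

    HomSep-agree : ∀ n r → Agree n r → ∀ E → HomSep (structure n r) T₁ E ≡ HomSep (structure n r) T₂ E
    HomSep-agree zero    r agree [] =
      trans (HomSep-[] (structure zero r) T₁) (trans agree (sym (HomSep-[] (structure zero r) T₂)))
    HomSep-agree (suc n) r agree [] =
      trans (HomSep-[] (structure (suc n) r) T₁) (trans (proj₁ agree) (sym (HomSep-[] (structure (suc n) r) T₂)))
    HomSep-agree (suc n) r agree ((c , d) ∷ E) =
      HomSep-cons r c d E (HomSep-agree (suc n) r agree E) (λ b a → HomSep-agree n (merge r b a) (proj₂ agree b a))

separates-sound : ∀ {m n} (f : Vec (Fin m) n) E → separates f E ≡ true →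
  ∀ {c d} → (c , d) ∈ E → lookup f c ≢ lookup f d
separates-sound f ((c , d) ∷ E) e cd∈ with lookup f c ≟ lookup f d
separates-sound f ((c , d) ∷ E) () cd∈          | yes _
separates-sound f ((c , d) ∷ E) e (here refl)   | no fc≢fd = fc≢fd
separates-sound f ((c , d) ∷ E) e (there cd∈)   | no _     = separates-sound f E e cd∈

separates-complete : ∀ {m n} (f : Vec (Fin m) n) E → (∀ {c d} → (c , d) ∈ E → lookup f c ≢ lookup f d) →
  separates f E ≡ true
separates-complete f []            h = refl
separates-complete f ((c , d) ∷ E) h =
  cong₂ _∧_ (cong not (dec-false (lookup f c ≟ lookup f d) (h (here refl)))) (separates-complete f E (h ∘ there))

distinct? : ∀ {n} (p : Fin n × Fin n) → Dec (proj₁ p ≢ proj₂ p)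
distinct? (i , j) = ¬? (i ≟ j)

offDiagonal : ∀ n → List (Fin n × Fin n)
offDiagonal n = filter distinct? (cartesianProduct (allFin n) (allFin n))

∈-offDiagonal : ∀ {n} {i j : Fin n} → i ≢ j → (i , j) ∈ offDiagonal n
∈-offDiagonal {i = i} {j} = ∈-filter⁺ distinct? (∈-cartesianProduct⁺ (∈-allFin i) (∈-allFin j))

offDiagonal-distinct : ∀ {n} {i j : Fin n} → (i , j) ∈ offDiagonal n → i ≢ j
offDiagonal-distinct {n} = proj₂ ∘ ∈-filter⁻ distinct? {xs = cartesianProduct (allFin n) (allFin n)}

separates⇒injective : ∀ {m n} (f : Vec (Fin m) n) → separates f (offDiagonal n) ≡ true →
  Injective _≡_ _≡_ (lookup f)
separates⇒injective f e {i} {j} fi≡fj with i ≟ j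
... | yes i≡j = i≡j
... | no  i≢j = ⊥-elim (separates-sound f _ e (∈-offDiagonal i≢j) fi≡fj)

injective⇒separates : ∀ {m n} (f : Vec (Fin m) n) → Injective _≡_ _≡_ (lookup f) →
  separates f (offDiagonal n) ≡ true
injective⇒separates f inj = separates-complete f _ (λ cd∈ → offDiagonal-distinct cd∈ ∘ inj)

vmap-injective : ∀ {A B : Set} {k} (g : A → B) → Injective _≡_ _≡_ g → Injective _≡_ _≡_ (vmap {n = k} g)
vmap-injective g inj {[]}    {[]}    _ = refl
vmap-injective g inj {x ∷ u} {y ∷ v} e = cong₂ _∷_ (inj (∷-injectiveˡ e)) (vmap-injective g inj (∷-injectiveʳ e))

module _ {σ : Signature} where

  -- If Hom(-, B) and Hom(-, B′) agree on B and its quotients, then B embeds into B′: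
  -- the identity is an injective homomorphism B → B, so some injective homomorphism B → B′ exists.
  embedding : (B B′ : Structure σ) → Agreement.Agree B B′ (size B) (rel B) →
    Σ (Fin (size B) → Fin (size B′)) λ g → IsHom B B′ g × Injective _≡_ _≡_ g
  embedding B B′ agree with countVec-witness (λ f → isHom? B B′ f ∧ separates f (offDiagonal (size B))) embeddings≢0
    where
    identity = tabulate id
    identity-lookup : ∀ x → x ≡ lookup identity x
    identity-lookup x = sym (lookup∘tabulate id x)
    identity-embeds : isHom? B B identity ∧ separates identity (offDiagonal (size B)) ≡ true
    identity-embeds = cong₂ _∧_
      (isHom?-complete B B identity (IsHom-cong B B identity-lookup
        (λ R t → subst (λ u → rel B R u ≡ true) (sym (map-id t)))))
      (injective⇒separates identity (λ {x} {y} e → trans (identity-lookup x) (trans e (sym (identity-lookup y)))))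
    embeddings≢0 : HomSep B B′ (offDiagonal (size B)) ≢ 0
    embeddings≢0 = countVec-positive _ identity identity-embeds
                 ∘ trans (Agreement.HomSep-agree B B′ (size B) (rel B) agree (offDiagonal (size B)))
  ... | f , e = lookup f , isHom?-sound B B′ f (∧-conicalˡ (isHom? B B′ f) _ e)
                         , separates⇒injective f (∧-conicalʳ (isHom? B B′ f) _ e)

  -- Finite structures embedding into each other are isomorphic: by counting, an injective
  -- homomorphism is then onto the universe and onto every relation.
  mutual-embeddings⇒Iso : (B B′ : Structure σ)
    (g : Fin (size B) → Fin (size B′)) (g′ : Fin (size B′) → Fin (size B)) →
    IsHom B B′ g → Injective _≡_ _≡_ g → IsHom B′ B g′ → Injective _≡_ _≡_ g′ → Iso B B′
  mutual-embeddings⇒Iso B B′ g g′ hom inj hom′ inj′ = mk⤖ {to = g} (inj , onto) , reflects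
    where
    everything : ∀ {N} → Fin N → Bool
    everything _ = true
    onto : ∀ y → Σ (Fin (size B)) λ x → ∀ {z} → z ≡ x → g z ≡ y
    onto y with count-surjection (size B) (size B′) everything everything g (λ _ _ → refl) (λ _ _ _ _ → inj)
                  (count-injection (size B′) (size B) everything everything g′ (λ _ _ → refl) (λ _ _ _ _ → inj′))
                  y refl
    ... | x , _ , gx≡y = x , λ { refl → gx≡y }
    reflects : ∀ R t → rel B R t ≡ rel B′ R (vmap g t)
    reflects R t = Bool-ext (hom R t) λ gt∈R →
      case-preimage (countVec-surjection (rel B R) (rel B′ R) (vmap g) (hom R) (λ _ _ _ _ → vmap-injective g inj)
                       fewer (vmap g t) gt∈R)
      where
      fewer = countVec-injection (rel B′ R) (rel B R) (vmap g′) (hom′ R) (λ _ _ _ _ → vmap-injective g′ inj′)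
      case-preimage : (Σ _ λ s → rel B R s ≡ true × vmap g s ≡ vmap g t) → rel B R t ≡ true
      case-preimage (s , s∈R , gs≡gt) = subst (λ u → rel B R u ≡ true) (vmap-injective g inj gs≡gt) s∈R

  separating-structure : (B B′ : Structure σ) → ¬ Iso B B′ → Σ (Structure σ) λ D → Hom D B ≢ Hom D B′
  separating-structure B B′ ¬iso
    with Agreement.agree? B B′ (size B) (rel B) | Agreement.agree? B′ B (size B′) (rel B′)
  ... | no ¬agree | _         = Agreement.disagreement B B′ (size B) (rel B) ¬agree
  ... | yes _     | no ¬agree with Agreement.disagreement B′ B (size B′) (rel B′) ¬agree
  ...   | D , differ = D , differ ∘ sym
  separating-structure B B′ ¬iso | yes agree | yes agree′
    with embedding B B′ agree | embedding B′ B agree′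
  ... | g , hom , inj | g′ , hom′ , inj′ = ⊥-elim (¬iso (mutual-embeddings⇒Iso B B′ g g′ hom inj hom′ inj′))

module _ {σ : Signature} (k : ℕ) (B : Fin k → Structure σ) where

  values : Structure σ → Fin k → ℕ
  values A i = Hom A (B i)

  Positive : Structure σ → Set
  Positive A = ∀ l → 0 < values A l

  Hom≢0-transfer : (∀ i j → HomEquiv (B i) (B j)) → ∀ D i l → values D i ≢ 0 → values D l ≢ 0
  Hom≢0-transfer equivalent D i l D→Bi with Hom≢0⇒hom D (B i) D→Bi | proj₁ (equivalent i l)
  ... | g , g-hom | h , h-hom = hom⇒Hom≢0 D (B l) (h ∘ g) (IsHom-∘ D (B i) (B l) g-hom h-hom)

  distinguishing⇒positive : (∀ i j → HomEquiv (B i) (B j)) → ∀ D i j → values D i ≢ values D j → Positive D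
  distinguishing⇒positive equivalent D i j differ l with values D i ≟ℕ 0
  ... | no  Di≢0 = n≢0⇒n>0 (Hom≢0-transfer equivalent D i l Di≢0)
  ... | yes Di≡0 = n≢0⇒n>0 (Hom≢0-transfer equivalent D j l (λ Dj≡0 → differ (trans Di≡0 (sym Dj≡0))))

  -- Refining A by D: the structure A^t ⊕ D, with t large enough for the inequality power-separates.
  exponent : Structure σ → Structure σ → ℕ
  exponent A D = sumFin k (λ l → values A l * values D l)

  refine : Structure σ → Structure σ → Structure σ
  refine A D = power A (exponent A D) ⊕ D

  values-refine : ∀ A D l → values (refine A D) l ≡ values A l ^ exponent A D * values D l
  values-refine A D l =
    trans (Hom-⊕ (power A (exponent A D)) D (B l)) (cong (_* values D l) (Hom-power A (B l) (exponent A D)))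

  refine-positive : ∀ A D → Positive A → Positive D → Positive (refine A D)
  refine-positive A D pos-A pos-D l = subst (0 <_) (sym (values-refine A D l))
    (*-mono-< (m^n>0 (values A l) {{>-nonZero (pos-A l)}} (exponent A D)) (pos-D l))

  refine-increases : ∀ A D → Positive A → Positive D →
    ∀ a b → values A a < values A b → values (refine A D) a < values (refine A D) b
  refine-increases A D pos-A pos-D a b a<b = subst₂ _<_ (sym (values-refine A D a)) (sym (values-refine A D b))
    (power-separates (values A a) (values A b) (values D a) (values D b) (exponent A D)
       (pos-A a) a<b (term≤sumFin k (λ l → values A l * values D l) a) (pos-D b))

  refine-distinguishes : ∀ A D → Positive A → Positive D →
    ∀ a b → (values A a ≡ values A b → values D a ≢ values D b) → values (refine A D) a ≢ values (refine A D) b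
  refine-distinguishes A D pos-A pos-D a b new with <-cmp (values A a) (values A b)
  ... | tri< a<b _ _  = <⇒≢ (refine-increases A D pos-A pos-D a b a<b)
  ... | tri> _ _ b<a  = <⇒≢ (refine-increases A D pos-A pos-D b a b<a) ∘ sym
  ... | tri≈ _ same _ = new same ∘ cancel
    where
    t = exponent A D
    instance _ = >-nonZero (m^n>0 (values A a) {{>-nonZero (pos-A a)}} t)
    cancel : values (refine A D) a ≡ values (refine A D) b → values D a ≡ values D b
    cancel e = *-cancelˡ-≡ _ _ (values A a ^ t)
      (trans (sym (values-refine A D a))
        (trans e (trans (values-refine A D b) (cong (λ v → v ^ t * values D b) (sym same)))))

  SeparatesAll : List (Fin k × Fin k) → Structure σ → Set
  SeparatesAll L A = Positive A × (∀ {i j} → (i , j) ∈ L → values A i ≢ values A j)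

  separate-all : (∀ i j → i ≢ j → ¬ Iso (B i) (B j)) → (∀ i j → HomEquiv (B i) (B j)) →
    ∀ L → (∀ {i j} → (i , j) ∈ L → i ≢ j) → Σ (Structure σ) (SeparatesAll L)
  separate-all non-iso equivalent []            _        =
    empty , (λ l → subst (0 <_) (sym (Hom-empty (B l))) (s≤s z≤n)) , λ ()
  separate-all non-iso equivalent ((i , j) ∷ L) distinct
    with separate-all non-iso equivalent L (distinct ∘ there)
       | separating-structure (B i) (B j) (non-iso i j (distinct (here refl)))
  ... | A , pos-A , old | D , D-differs = refine A D , refine-positive A D pos-A pos-D , separated
    where
    pos-D = distinguishing⇒positive equivalent D i j D-differs
    separated : ∀ {a b} → (a , b) ∈ (i , j) ∷ L → values (refine A D) a ≢ values (refine A D) b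
    separated (here refl) = refine-distinguishes A D pos-A pos-D i j (λ _ → D-differs)
    separated (there ab∈) = refine-distinguishes A D pos-A pos-D _ _ (λ same → ⊥-elim (old ab∈ same))

-- The theorem: separate all pairs of distinct indices.
lemma3p2 : (σ : Signature) (k : ℕ) → k ≥ 1 →
    (B : Fin k → Structure σ) →
    (∀ i j → i ≢ j → ¬ Iso (B i) (B j)) →
    (∀ i j → HomEquiv (B i) (B j)) →
    Σ (Structure σ) λ A →
      (∀ i → Hom A (B i) ≢ 0) × (∀ i j → i ≢ j → Hom A (B i) ≢ Hom A (B j))
lemma3p2 σ k _ B non-iso equivalent
  with separate-all k B non-iso equivalent (offDiagonal k) offDiagonal-distinct
... | A , positive , distinct =
  A , (λ i → n>0⇒n≢0 (positive i)) , (λ i j i≢j → distinct (∈-offDiagonal i≢j))
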